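{- For every odd positive integer $\ell$, $B_\ell\ \ge\ \dfrac{2^\ell}{16(\ell-4)}$.
   Context: A bidirectional ballot sequence is a finite 0-1 sequence such that every nonempty prefix and every nonempty suffix contains strictly more ones than zeros. $B_\ell$ denotes the number of bidirectional ballot sequences of length $\ell$. -}

module Defs where

open import Data.Bool using (Bool; true; false)
open import Data.Nat using (ℕ; zero; suc; _+_; _<_; _<?_)
open import Data.List using (List; []; _∷_; length; filter; map; _++_; reverse)
open import Data.List.Relation.Unary.All using (All)
open import Data.List.Relation.Unary.All using (all?)
open import Relation.Nullary using (Dec; _×-dec_)

ones : List Bool → ℕ
ones []          = 0
ones (true ∷ xs)  = suc (ones xs)
ones (false ∷ xs) = ones xs

zeros : List Bool → ℕ
zeros []          = 0
zeros (true ∷ xs)  = zeros xs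
zeros (false ∷ xs) = suc (zeros xs)

nonemptyPrefixes : List Bool → List (List Bool)
nonemptyPrefixes []       = []
nonemptyPrefixes (x ∷ xs) = (x ∷ []) ∷ map (x ∷_) (nonemptyPrefixes xs)

nonemptySuffixes : List Bool → List (List Bool)
nonemptySuffixes []       = []
nonemptySuffixes (x ∷ xs) = (x ∷ xs) ∷ nonemptySuffixes xs

MoreOnes : List Bool → Set
MoreOnes w = zeros w < ones w

moreOnes? : (w : List Bool) → Dec (MoreOnes w)
moreOnes? w = zeros w <? ones w

IsBBS : List Bool → Set
IsBBS s = All MoreOnes (nonemptyPrefixes s) Data.Product.× All MoreOnes (nonemptySuffixes s)
  where import Data.Product

isBBS? : (s : List Bool) → Dec (IsBBS s)
isBBS? s = all? moreOnes? (nonemptyPrefixes s) ×-dec all? moreOnes? (nonemptySuffixes s)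

allSeqs : ℕ → List (List Bool)
allSeqs zero    = [] ∷ []
allSeqs (suc n) = map (true ∷_) (allSeqs n) ++ map (false ∷_) (allSeqs n)

B : ℕ → ℕ
B ℓ = length (filter isBBS? (allSeqs ℓ))

module Submission where

-- Read a 0-1 sequence as a lattice walk (1 = up, 0 = down).  Call s a ballot
-- sequence if every nonempty prefix has more ones than zeros; s is a
-- bidirectional ballot sequence as soon as s and reverse s are both ballot
-- sequences.  Both events are increasing for the coordinatewise order on
-- {0,1}^ℓ, so the Harris inequality gives  F_ℓ² ≤ B_ℓ · 2^ℓ,  where F_ℓ counts
-- ballot sequences of length ℓ (reversal does not change that count).
-- For ℓ = 2K+1 a ballot sequence is a 1 followed by a walk of length 2K that
-- never goes below its starting height; by the reflection principle such walks
-- are as many as the unconstrained ones with final displacement in [0, 1], so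
-- F_ℓ ≥ C(2K, K).  The estimate 16^K ≤ 4K·C(2K,K)² then yields, for K ≥ 3,
--   2^ℓ · 2^ℓ = 4·16^K ≤ 16K·F_ℓ² ≤ 16(ℓ − 4)·B_ℓ·2^ℓ.

open import Defs
open import Algebra.Properties.CommutativeSemigroup using (interchange)
open import Data.Bool using (Bool; true; false; _∧_; T)
open import Data.Bool.Base using (f≤t; b≤b) renaming (_≤_ to _≤𝔹_)
open import Data.Bool.Properties using (T-∧; T-≡)
open import Data.Empty using (⊥-elim)
open import Data.List using (List; []; _∷_; length; filter; map; _++_; reverse; _∷ʳ_)
open import Data.List.Properties using (filter-++; length-++; map-++; unfold-reverse)
open import Data.List.Relation.Binary.Pointwise as Pointwise using (Pointwise; []; _∷_; reverse⁺)
open import Data.List.Relation.Unary.All as All using (All; []; _∷_)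
open import Data.List.Relation.Unary.All.Properties using (map⁺; ++⁻)
open import Data.Nat using (ℕ; zero; suc; _+_; _*_; _∸_; _^_; _≤_; _<_; z≤n; s≤s; _≤ᵇ_; _≡ᵇ_)
open import Data.Nat.Divisibility using (_∣_; divides; ∣-refl; ∣m∣n⇒∣m+n)
open import Data.Nat.Properties
open import Data.Nat.Tactic.RingSolver using (solve-∀)
open import Data.Product using (∃-syntax; _,_)
open import Function using (_∘_)
open import Function.Bundles using (Equivalence)
open import Relation.Binary.PropositionalEquality
  using (_≡_; refl; sym; trans; cong; cong₂; subst; subst₂; module ≡-Reasoning)
open import Relation.Nullary using (¬_; does)
open import Relation.Nullary.Decidable using (dec-true)
open import Relation.Unary using (Decidable)

+-interchange : ∀ a b c d → (a + b) + (c + d) ≡ (a + c) + (b + d)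
+-interchange = interchange +-commutativeSemigroup

bit : Bool → ℕ
bit true  = 1
bit false = 0

bit-mono : ∀ {a b} → (T a → T b) → bit a ≤ bit b
bit-mono {false}         _   = z≤n
bit-mono {true} {true}   _   = ≤-refl
bit-mono {true} {false}  a⇒b = ⊥-elim (a⇒b _)

count : (List Bool → Bool) → ℕ → ℕ
count f zero    = bit (f [])
count f (suc n) = count (λ s → f (true ∷ s)) n + count (λ s → f (false ∷ s)) n

length-filter-map : ∀ {P : List Bool → Set} (P? : Decidable P) (g : List Bool → List Bool) xs →
  length (filter P? (map g xs)) ≡ length (filter (λ s → P? (g s)) xs)
length-filter-map P? g []       = refl
length-filter-map P? g (x ∷ xs) with does (P? (g x))
... | true  = cong suc (length-filter-map P? g xs)
... | false = length-filter-map P? g xs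

length-filter-allSeqs : ∀ {P : List Bool → Set} (P? : Decidable P) n →
  length (filter P? (allSeqs n)) ≡ count (λ s → does (P? s)) n
length-filter-allSeqs P? zero with does (P? [])
... | true  = refl
... | false = refl
length-filter-allSeqs P? (suc n) = begin
    length (filter P? (withOne ++ withZero))
  ≡⟨ cong length (filter-++ P? withOne withZero) ⟩
    length (filter P? withOne ++ filter P? withZero)
  ≡⟨ length-++ (filter P? withOne) ⟩
    length (filter P? withOne) + length (filter P? withZero)
  ≡⟨ cong₂ _+_ (trans (length-filter-map P? (true ∷_) (allSeqs n)) (length-filter-allSeqs _ n))
               (trans (length-filter-map P? (false ∷_) (allSeqs n)) (length-filter-allSeqs _ n)) ⟩
    count (λ s → does (P? s)) (suc n)
  ∎
  where
  open ≡-Reasoning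
  withOne  = map (true ∷_) (allSeqs n)
  withZero = map (false ∷_) (allSeqs n)

B≡count : ∀ ℓ → B ℓ ≡ count (λ s → does (isBBS? s)) ℓ
B≡count = length-filter-allSeqs isBBS?

count-never : ∀ n → count (λ _ → false) n ≡ 0
count-never zero    = refl
count-never (suc n) = cong₂ _+_ (count-never n) (count-never n)

count-cong : ∀ {f g} n → (∀ s → f s ≡ g s) → count f n ≡ count g n
count-cong zero    f≗g = cong bit (f≗g [])
count-cong (suc n) f≗g =
  cong₂ _+_ (count-cong n (f≗g ∘ (true ∷_))) (count-cong n (f≗g ∘ (false ∷_)))

count-mono : ∀ {f g} n → (∀ s → length s ≡ n → T (f s) → T (g s)) → count f n ≤ count g n
count-mono zero    f⇒g = bit-mono (f⇒g [] refl)
count-mono (suc n) f⇒g =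
  +-mono-≤ (count-mono n (λ s eq → f⇒g (true ∷ s) (cong suc eq)))
           (count-mono n (λ s eq → f⇒g (false ∷ s) (cong suc eq)))

count-pointwise : ∀ {f g f′ g′} n → (∀ s → bit (f s) + bit (g s) ≡ bit (f′ s) + bit (g′ s)) →
  count f n + count g n ≡ count f′ n + count g′ n
count-pointwise zero    same = same []
count-pointwise {f} {g} {f′} {g′} (suc n) same =
  trans (+-interchange (count (f ∘ (true ∷_)) n) (count (f ∘ (false ∷_)) n) _ _)
    (trans (cong₂ _+_ (count-pointwise {f ∘ (true ∷_)} {g ∘ (true ∷_)} n (same ∘ (true ∷_)))
                      (count-pointwise {f ∘ (false ∷_)} {g ∘ (false ∷_)} n (same ∘ (false ∷_))))
      (+-interchange (count (f′ ∘ (true ∷_)) n) (count (g′ ∘ (true ∷_)) n) _ _))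

count-snoc : ∀ f n → count f (suc n) ≡ count (λ s → f (s ∷ʳ true)) n + count (λ s → f (s ∷ʳ false)) n
count-snoc f zero    = refl
count-snoc f (suc n) =
  trans (cong₂ _+_ (count-snoc (f ∘ (true ∷_)) n) (count-snoc (f ∘ (false ∷_)) n))
        (+-interchange (count (λ s → f (true ∷ s ∷ʳ true)) n) (count (λ s → f (true ∷ s ∷ʳ false)) n) _ _)

count-reverse : ∀ f n → count (λ s → f (reverse s)) n ≡ count f n
count-reverse f zero    = refl
count-reverse f (suc n) = begin
    count (λ s → f (reverse (true ∷ s))) n + count (λ s → f (reverse (false ∷ s))) n
  ≡⟨ cong₂ _+_ (count-cong n (cong f ∘ unfold-reverse true)) (count-cong n (cong f ∘ unfold-reverse false)) ⟩
    count (λ s → f (reverse s ∷ʳ true)) n + count (λ s → f (reverse s ∷ʳ false)) n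
  ≡⟨ cong₂ _+_ (count-reverse (λ s → f (s ∷ʳ true)) n) (count-reverse (λ s → f (s ∷ʳ false)) n) ⟩
    count (λ s → f (s ∷ʳ true)) n + count (λ s → f (s ∷ʳ false)) n
  ≡⟨ count-snoc f n ⟨
    count f (suc n)
  ∎
  where open ≡-Reasoning

Increasing : (List Bool → Bool) → Set
Increasing f = ∀ {xs ys} → Pointwise _≤𝔹_ xs ys → T (f xs) → T (f ys)

increasing-cons : ∀ {f} b → Increasing f → Increasing (λ s → f (b ∷ s))
increasing-cons b inc xs≤ys = inc (b≤b ∷ xs≤ys)

increasing-head : ∀ {f} → Increasing f → ∀ s → T (f (false ∷ s)) → T (f (true ∷ s))
increasing-head inc s = inc (f≤t ∷ Pointwise.refl b≤b)

increasing-reverse : ∀ {f} → Increasing f → Increasing (λ s → f (reverse s))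
increasing-reverse inc xs≤ys = inc (reverse⁺ xs≤ys)

chebyshev : ∀ {a₀ a₁ b₀ b₁} → a₀ ≤ a₁ → b₀ ≤ b₁ → (a₁ + a₀) * (b₁ + b₀) ≤ 2 * (a₁ * b₁ + a₀ * b₀)
chebyshev {a₀} {_} {b₀} a₀≤a₁ b₀≤b₁ with m≤n⇒∃[o]m+o≡n a₀≤a₁ | m≤n⇒∃[o]m+o≡n b₀≤b₁
... | x , refl | y , refl = ≤-trans (m≤m+n _ (x * y)) (≤-reflexive (identity a₀ x b₀ y))
  where
  identity : ∀ a x b y → (a + x + a) * (b + y + b) + x * y ≡ 2 * ((a + x) * (b + y) + a * b)
  identity = solve-∀

-- Induction on n, splitting on the
-- first letter and combining the two halves by Chebyshev's inequality.
harris : ∀ n f g → Increasing f → Increasing g →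
  count f n * count g n ≤ count (λ s → f s ∧ g s) n * 2 ^ n
harris zero f g _ _ with f [] | g []
... | true  | true  = ≤-refl
... | true  | false = z≤n
... | false | _     = z≤n
harris (suc n) f g incf incg = begin
    (F₁ + F₀) * (G₁ + G₀)
  ≤⟨ chebyshev (count-mono n (λ s _ → increasing-head incf s)) (count-mono n (λ s _ → increasing-head incg s)) ⟩
    2 * (F₁ * G₁ + F₀ * G₀)
  ≤⟨ *-monoʳ-≤ 2 (+-mono-≤ (harris n _ _ (increasing-cons true incf) (increasing-cons true incg))
                           (harris n _ _ (increasing-cons false incf) (increasing-cons false incg))) ⟩
    2 * (H₁ * 2 ^ n + H₀ * 2 ^ n)
  ≡⟨ collect H₁ H₀ (2 ^ n) ⟩
    (H₁ + H₀) * 2 ^ suc n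
  ∎
  where
  open ≤-Reasoning
  F₁ = count (λ s → f (true ∷ s)) n
  F₀ = count (λ s → f (false ∷ s)) n
  G₁ = count (λ s → g (true ∷ s)) n
  G₀ = count (λ s → g (false ∷ s)) n
  H₁ = count (λ s → f (true ∷ s) ∧ g (true ∷ s)) n
  H₀ = count (λ s → f (false ∷ s) ∧ g (false ∷ s)) n
  collect : ∀ a b p → 2 * (a * p + b * p) ≡ (a + b) * (2 * p)
  collect = solve-∀

nonneg : ℕ → List Bool → Bool
nonneg h       []          = true
nonneg h       (true ∷ s)  = nonneg (suc h) s
nonneg zero    (false ∷ s) = false
nonneg (suc h) (false ∷ s) = nonneg h s

-- ballot s: every nonempty prefix of s has more ones than zeros, i.e. s starts
-- with a one and its walk then never returns below height 1.
ballot : List Bool → Bool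
ballot []          = true
ballot (true ∷ s)  = nonneg 0 s
ballot (false ∷ s) = false

nonneg-mono : ∀ {h h′ s t} → h ≤ h′ → Pointwise _≤𝔹_ s t → T (nonneg h s) → T (nonneg h′ t)
nonneg-mono                 _          []                 _  = _
nonneg-mono                 h≤h′       (b≤b {true} ∷ s≤t)  ok = nonneg-mono (s≤s h≤h′) s≤t ok
nonneg-mono {suc h} {suc _} (s≤s h≤h′) (b≤b {false} ∷ s≤t) ok = nonneg-mono h≤h′ s≤t ok
nonneg-mono {suc h}         h<h′       (f≤t ∷ s≤t)         ok = nonneg-mono (m≤n⇒m≤1+n (<⇒≤ h<h′)) s≤t ok
nonneg-mono {zero}          _          (b≤b {false} ∷ _)   ()
nonneg-mono {zero}          _          (f≤t ∷ _)           ()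

ballot-increasing : Increasing ballot
ballot-increasing []                  _  = _
ballot-increasing (b≤b {true} ∷ s≤t)  ok = nonneg-mono {0} {0} z≤n s≤t ok
ballot-increasing (b≤b {false} ∷ _)   ()
ballot-increasing (f≤t ∷ _)           ()

nonneg-prefixes : ∀ h s → T (nonneg h s) → All (λ w → zeros w ≤ h + ones w) (nonemptyPrefixes s)
nonneg-prefixes h       []          _  = []
nonneg-prefixes h       (true ∷ s)  ok =
  z≤n ∷ map⁺ (All.map (λ {w} le → ≤-trans le (≤-reflexive (sym (+-suc h (ones w)))))
                      (nonneg-prefixes (suc h) s ok))
nonneg-prefixes (suc h) (false ∷ s) ok = s≤s z≤n ∷ map⁺ (All.map s≤s (nonneg-prefixes h s ok))
nonneg-prefixes zero    (false ∷ s) ()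

ballot-prefixes : ∀ s → T (ballot s) → All MoreOnes (nonemptyPrefixes s)
ballot-prefixes []         _  = []
ballot-prefixes (true ∷ s) ok = s≤s z≤n ∷ map⁺ (All.map s≤s (nonneg-prefixes 0 s ok))

prefixes-snoc : ∀ t x → nonemptyPrefixes (t ∷ʳ x) ≡ nonemptyPrefixes t ∷ʳ (t ∷ʳ x)
prefixes-snoc []      x = refl
prefixes-snoc (y ∷ t) x = cong ((y ∷ []) ∷_)
  (trans (cong (map (y ∷_)) (prefixes-snoc t x)) (map-++ (y ∷_) (nonemptyPrefixes t) _))

ones-++ : ∀ a b → ones (a ++ b) ≡ ones a + ones b
ones-++ []          b = refl
ones-++ (true ∷ a)  b = cong suc (ones-++ a b)
ones-++ (false ∷ a) b = ones-++ a b

zeros-++ : ∀ a b → zeros (a ++ b) ≡ zeros a + zeros b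
zeros-++ []          b = refl
zeros-++ (true ∷ a)  b = zeros-++ a b
zeros-++ (false ∷ a) b = cong suc (zeros-++ a b)

reverse-invariant : ∀ (c : List Bool → ℕ) → (∀ a b → c (a ++ b) ≡ c a + c b) →
  ∀ s → c (reverse s) ≡ c s
reverse-invariant c c-++ []      = refl
reverse-invariant c c-++ (x ∷ s) = begin
    c (reverse (x ∷ s))        ≡⟨ cong c (unfold-reverse x s) ⟩
    c (reverse s ∷ʳ x)         ≡⟨ c-++ (reverse s) (x ∷ []) ⟩
    c (reverse s) + c (x ∷ []) ≡⟨ cong (_+ c (x ∷ [])) (reverse-invariant c c-++ s) ⟩
    c s + c (x ∷ [])           ≡⟨ +-comm (c s) (c (x ∷ [])) ⟩
    c (x ∷ []) + c s           ≡⟨ c-++ (x ∷ []) s ⟨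
    c (x ∷ s)                  ∎
  where open ≡-Reasoning

moreOnes-reverse : ∀ s → MoreOnes (reverse s) → MoreOnes s
moreOnes-reverse s = subst₂ _<_ (reverse-invariant zeros zeros-++ s) (reverse-invariant ones ones-++ s)

-- The suffixes of s are the reversed prefixes of reverse s.
suffixes-from-reverse : ∀ s → All MoreOnes (nonemptyPrefixes (reverse s)) → All MoreOnes (nonemptySuffixes s)
suffixes-from-reverse []      _    = []
suffixes-from-reverse (x ∷ s) good
  with ++⁻ (nonemptyPrefixes (reverse s))
           (subst (All MoreOnes) (trans (cong nonemptyPrefixes (unfold-reverse x s)) (prefixes-snoc (reverse s) x)) good)
... | rest , (whole ∷ []) =
  moreOnes-reverse (x ∷ s) (subst MoreOnes (sym (unfold-reverse x s)) whole)
  ∷ suffixes-from-reverse s rest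

ballot-both⇒BBS : ∀ s → T (ballot s ∧ ballot (reverse s)) → T (does (isBBS? s))
ballot-both⇒BBS s ok with Equivalence.to (T-∧ {ballot s} {ballot (reverse s)}) ok
... | forward , backward = Equivalence.from (T-≡ {does (isBBS? s)}) (dec-true (isBBS? s)
  (ballot-prefixes s forward , suffixes-from-reverse s (ballot-prefixes (reverse s) backward)))

ballot-square : ∀ ℓ → count ballot ℓ * count ballot ℓ ≤ B ℓ * 2 ^ ℓ
ballot-square ℓ = begin
    count ballot ℓ * count ballot ℓ
  ≡⟨ cong (count ballot ℓ *_) (count-reverse ballot ℓ) ⟨
    count ballot ℓ * count (λ s → ballot (reverse s)) ℓ
  ≤⟨ harris ℓ ballot (ballot ∘ reverse) ballot-increasing (increasing-reverse ballot-increasing) ⟩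
    count (λ s → ballot s ∧ ballot (reverse s)) ℓ * 2 ^ ℓ
  ≤⟨ *-monoˡ-≤ (2 ^ ℓ) (count-mono ℓ (λ s _ → ballot-both⇒BBS s)) ⟩
    count (λ s → does (isBBS? s)) ℓ * 2 ^ ℓ
  ≡⟨ cong (_* 2 ^ ℓ) (B≡count ℓ) ⟨
    B ℓ * 2 ^ ℓ
  ∎
  where open ≤-Reasoning

-- window lo hi s: the displacement ones s − zeros s lies in the interval [−lo, hi].
window : ℕ → ℕ → List Bool → Bool
window lo hi s = (zeros s ≤ᵇ ones s + lo) ∧ (ones s ≤ᵇ zeros s + hi)

≤ᵇ-suc : ∀ m n → (suc m ≤ᵇ suc n) ≡ (m ≤ᵇ n)
≤ᵇ-suc zero    n = refl
≤ᵇ-suc (suc m) n = refl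

≤ᵇ-weaken : ∀ {k m n} → m ≤ n → T (k ≤ᵇ m) → T (k ≤ᵇ n)
≤ᵇ-weaken {k} {m} m≤n k≤m = ≤⇒≤ᵇ (≤-trans (≤ᵇ⇒≤ k m k≤m) m≤n)

≰ᵇ⇒> : ∀ {m n} → ¬ T (m ≤ᵇ n) → n < m
≰ᵇ⇒> m≰n = ≰⇒> (m≰n ∘ ≤⇒≤ᵇ)

window-cons-true : ∀ lo hi s → window lo (suc hi) (true ∷ s) ≡ window (suc lo) hi s
window-cons-true lo hi s = cong₂ _∧_
  (cong (zeros s ≤ᵇ_) (sym (+-suc (ones s) lo)))
  (trans (cong (suc (ones s) ≤ᵇ_) (+-suc (zeros s) hi)) (≤ᵇ-suc (ones s) (zeros s + hi)))

window-cons-false : ∀ lo hi s → window (suc lo) hi (false ∷ s) ≡ window lo (suc hi) s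
window-cons-false lo hi s = cong₂ _∧_
  (trans (cong (suc (zeros s) ≤ᵇ_) (+-suc (ones s) lo)) (≤ᵇ-suc (zeros s) (ones s + lo)))
  (cong (ones s ≤ᵇ_) (sym (+-suc (zeros s) hi)))

-- The Boolean content of 1_{[−a′,b]} + 1_{[−a,b′]} = 1_{[−a′,b′]} + 1_{[−a,b]}
-- for a ≤ a′ and b ≤ b′ (union plus intersection; both intervals contain 0).
swap-bits : ∀ a a′ b b′ → (T a → T a′) → (T b → T b′) → (¬ T a → T b) →
  bit (a′ ∧ b) + bit (a ∧ b′) ≡ bit (a′ ∧ b′) + bit (a ∧ b)
swap-bits true  true  b     b′    _    _    _    = +-comm (bit b) (bit b′)
swap-bits true  false _     _     a⇒a′ _    _    = ⊥-elim (a⇒a′ _)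
swap-bits false a′    true  true  _    _    _    = refl
swap-bits false a′    true  false _    b⇒b′ _    = ⊥-elim (b⇒b′ _)
swap-bits false a′    false _     _    _    ¬a⇒b = ⊥-elim (¬a⇒b λ ())

window-swap : ∀ {a a′ b b′} → a ≤ a′ → b ≤ b′ → ∀ s →
  bit (window a′ b s) + bit (window a b′ s) ≡ bit (window a′ b′ s) + bit (window a b s)
window-swap {a} {_} {b} a≤a′ b≤b′ s = swap-bits _ _ _ _
  (≤ᵇ-weaken {z} (+-monoʳ-≤ o a≤a′))
  (≤ᵇ-weaken {o} (+-monoʳ-≤ z b≤b′))
  (λ z≰o+a → ≤⇒≤ᵇ (≤-trans (≤-trans (m≤m+n o a) (<⇒≤ (≰ᵇ⇒> z≰o+a))) (m≤m+n z b)))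
  where
  o = ones s
  z = zeros s

-- The Boolean content of 1_{[−1,2]} = 1_{[−1,0]} + 1_{[1,2]}.
split-bits : ∀ a b c d → (T c → T a) → (T b → T d) → (T b → ¬ T c) → (¬ T b → T c) →
  bit (a ∧ d) + bit false ≡ bit (a ∧ b) + bit (c ∧ d)
split-bits a     true  false true  _   _   _    _    = refl
split-bits a     true  false false _   b⇒d _    _    = ⊥-elim (b⇒d _)
split-bits a     true  true  d     _   _   b⇒¬c _    = ⊥-elim (b⇒¬c _ _)
split-bits true  false true  d     _   _   _    _    = +-comm (bit d) 0
split-bits false false true  d     c⇒a _   _    _    = ⊥-elim (c⇒a _)
split-bits a     false false d     _   _   _    ¬b⇒c = ⊥-elim (¬b⇒c λ ())

-- Base of the window induction: a sequence of length n+1 with displacement in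
-- [0, 1] is a one followed by displacement in [−1, 0], or a zero followed by
-- displacement in [1, 2]; together these tile [−1, 2].
window-split : ∀ s → bit (window 1 2 s) + bit false ≡ bit (window 0 1 (true ∷ s)) + bit (window 0 1 (false ∷ s))
window-split s = begin
    bit (window 1 2 s) + bit false
  ≡⟨ cong (λ k → bit ((z ≤ᵇ o + 1) ∧ (o ≤ᵇ k)) + bit false) (+-suc z 1) ⟩
    bit ((z ≤ᵇ o + 1) ∧ (o ≤ᵇ suc z + 1)) + bit false
  ≡⟨ split-bits _ _ _ _ lower below below⇒¬above ¬below⇒above ⟩
    bit (window 1 0 s) + bit (window 0 1 (false ∷ s))
  ≡⟨ cong (λ w → bit w + bit (window 0 1 (false ∷ s))) (window-cons-true 0 0 s) ⟨
    bit (window 0 1 (true ∷ s)) + bit (window 0 1 (false ∷ s))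
  ∎
  where
  open ≡-Reasoning
  o = ones s
  z = zeros s
  lower : T (suc z ≤ᵇ o + 0) → T (z ≤ᵇ o + 1)
  lower above = ≤⇒≤ᵇ (≤-trans (n≤1+n z) (≤-trans (≤ᵇ⇒≤ _ _ above) (+-monoʳ-≤ o z≤n)))
  below : T (o ≤ᵇ z + 0) → T (o ≤ᵇ suc z + 1)
  below = ≤ᵇ-weaken {o} (≤-trans (+-monoʳ-≤ z (z≤n {1})) (n≤1+n (z + 1)))
  below⇒¬above : T (o ≤ᵇ z + 0) → ¬ T (suc z ≤ᵇ o + 0)
  below⇒¬above o≤z z<o = 1+n≰n (≤-trans (≤-trans (≤ᵇ⇒≤ _ _ z<o) (≤-reflexive (+-identityʳ o)))
                                        (≤-trans (≤ᵇ⇒≤ _ _ o≤z) (≤-reflexive (+-identityʳ z))))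
  ¬below⇒above : ¬ T (o ≤ᵇ z + 0) → T (suc z ≤ᵇ o + 0)
  ¬below⇒above o≰z = ≤⇒≤ᵇ (subst₂ _≤_ (cong suc (+-identityʳ z)) (sym (+-identityʳ o)) (≰ᵇ⇒> o≰z))

-- For the induction step in heights ≥ 1: the first letter shifts the window,
-- and the two shifted windows recombine into the windows for heights h+2 and h.
window-step : ∀ h s →
  bit (window (2 + h) (3 + h) s) + bit (window h (1 + h) s)
    ≡ bit (window (1 + h) (2 + h) (true ∷ s)) + bit (window (1 + h) (2 + h) (false ∷ s))
window-step h s = begin
    bit (window (2 + h) (3 + h) s) + bit (window h (1 + h) s)
  ≡⟨ window-swap (m≤n+m h 2) (m≤n+m (1 + h) 2) s ⟨
    bit (window (2 + h) (1 + h) s) + bit (window h (3 + h) s)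
  ≡⟨ cong₂ (λ u v → bit u + bit v) (window-cons-true (1 + h) (1 + h) s) (window-cons-false h (2 + h) s) ⟨
    bit (window (1 + h) (2 + h) (true ∷ s)) + bit (window (1 + h) (2 + h) (false ∷ s))
  ∎
  where open ≡-Reasoning

nonneg-count : ∀ n h → count (nonneg h) n ≡ count (window h (suc h)) n
nonneg-count zero    h       = refl
nonneg-count (suc n) zero    =
  trans (cong (_+ count (λ _ → false) n) (nonneg-count n 1)) (count-pointwise n window-split)
nonneg-count (suc n) (suc h) =
  trans (cong₂ _+_ (nonneg-count n (2 + h)) (nonneg-count n h)) (count-pointwise n (window-step h))

-- Binomial coefficients by Pascal's rule (the library's _C_ is defined by division,
-- which is ill-suited to the inductive arguments below).
binom : ℕ → ℕ → ℕ
binom n       zero    = 1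
binom zero    (suc k) = 0
binom (suc n) (suc k) = binom n k + binom n (suc k)

count-ones : ∀ n k → count (λ s → ones s ≡ᵇ k) n ≡ binom n k
count-ones zero    zero    = refl
count-ones zero    (suc k) = refl
count-ones (suc n) zero    = cong₂ _+_ (count-never n) (count-ones n 0)
count-ones (suc n) (suc k) = cong₂ _+_ (count-ones n k) (count-ones n (suc k))

binom-above : ∀ {n k} → n < k → binom n k ≡ 0
binom-above {zero}  {suc k} _         = refl
binom-above {suc n} {suc k} (s≤s n<k) = cong₂ _+_ (binom-above n<k) (binom-above (m≤n⇒m≤1+n n<k))

binom-diag : ∀ n → binom n n ≡ 1
binom-diag zero    = refl
binom-diag (suc n) = cong₂ _+_ (binom-diag n) (binom-above (n<1+n n))

binom-sym : ∀ a b → binom (a + b) a ≡ binom (a + b) b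
binom-sym zero    b       = sym (binom-diag b)
binom-sym (suc a) zero    = trans (cong (λ n → binom n (suc a)) (+-identityʳ (suc a))) (binom-diag (suc a))
binom-sym (suc a) (suc b) = trans
  (cong₂ _+_ (binom-sym a (suc b))
             (subst (λ n → binom n (suc a) ≡ binom n b) (sym (+-suc a b)) (binom-sym (suc a) b)))
  (+-comm (binom (a + suc b) (suc b)) (binom (a + suc b) b))

binom-absorb : ∀ n k → suc k * binom (suc n) (suc k) ≡ suc n * binom n k
binom-absorb zero    zero    = refl
binom-absorb zero    (suc k) = *-zeroʳ (suc (suc k))
binom-absorb (suc n) zero    =
  trans (*-identityˡ _) (cong suc (trans (sym (*-identityˡ _)) (binom-absorb n 0)))
binom-absorb (suc n) (suc k) = begin
    suc (suc k) * (C₁ + C₂)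
  ≡⟨ *-distribˡ-+ (suc (suc k)) C₁ C₂ ⟩
    C₁ + suc k * C₁ + suc (suc k) * C₂
  ≡⟨ cong₂ (λ x y → C₁ + x + y) (binom-absorb n k) (binom-absorb n (suc k)) ⟩
    C₁ + suc n * binom n k + suc n * binom n (suc k)
  ≡⟨ regroup n (binom n k) (binom n (suc k)) ⟩
    suc (suc n) * C₁
  ∎
  where
  open ≡-Reasoning
  C₁ = binom (suc n) (suc k)
  C₂ = binom (suc n) (suc (suc k))
  regroup : ∀ m x y → (x + y) + suc m * x + suc m * y ≡ suc (suc m) * (x + y)
  regroup = solve-∀

central : ℕ → ℕ
central K = binom (K + K) K

central-step : ∀ K → suc K * central (suc K) ≡ 2 * (suc (K + K) * central K)
central-step K rewrite +-suc K K = begin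
    suc K * (binom (suc (K + K)) K + D)
  ≡⟨ cong (λ x → suc K * (x + D)) (subst (λ n → binom n K ≡ binom n (suc K)) (+-suc K K) (binom-sym K (suc K))) ⟩
    suc K * (D + D)
  ≡⟨ *-distribˡ-+ (suc K) D D ⟩
    suc K * D + suc K * D
  ≡⟨ cong₂ _+_ (binom-absorb (K + K) K) (binom-absorb (K + K) K) ⟩
    suc (K + K) * central K + suc (K + K) * central K
  ≡⟨ cong (suc (K + K) * central K +_) (+-identityʳ _) ⟨
    2 * (suc (K + K) * central K)
  ∎
  where
  open ≡-Reasoning
  D = binom (suc (K + K)) (suc K)

-- 16^K ≤ 4K·C(2K, K)² for K ≥ 1, i.e. C(2K, K) ≥ 4^K / (2√K).  Induction on K:
-- the ratio of consecutive sides is governed by (2K+1)² ≥ 4K(K+1).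
central-bound : ∀ m → 16 ^ suc m ≤ 4 * suc m * central (suc m) * central (suc m)
central-bound zero    = ≤-refl
central-bound (suc m) = *-cancelˡ-≤ (K * suc K) (begin
    K * suc K * (16 * 16 ^ K)
  ≡⟨ e₁ K (16 ^ K) ⟩
    16 * K * suc K * 16 ^ K
  ≤⟨ *-monoʳ-≤ (16 * K * suc K) (central-bound m) ⟩
    16 * K * suc K * (4 * K * c * c)
  ≤⟨ *-monoˡ-≤ (4 * K * c * c) (≤-trans (m≤m+n (16 * K * suc K) 4) (≤-reflexive (e₂ K))) ⟩
    4 * suc (K + K) * suc (K + K) * (4 * K * c * c)
  ≡⟨ e₃ K (suc (K + K)) c ⟩
    4 * K * (2 * (suc (K + K) * c)) * (2 * (suc (K + K) * c))
  ≡⟨ cong (λ x → 4 * K * x * x) (central-step K) ⟨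
    4 * K * (suc K * c′) * (suc K * c′)
  ≡⟨ e₄ K c′ ⟩
    K * suc K * (4 * suc K * c′ * c′)
  ∎)
  where
  open ≤-Reasoning
  K  = suc m
  c  = central K
  c′ = central (suc K)
  e₁ : ∀ K x → K * suc K * (16 * x) ≡ 16 * K * suc K * x
  e₁ = solve-∀
  e₂ : ∀ K → 16 * K * suc K + 4 ≡ 4 * suc (K + K) * suc (K + K)
  e₂ = solve-∀
  e₃ : ∀ K s c → 4 * s * s * (4 * K * c * c) ≡ 4 * K * (2 * (s * c)) * (2 * (s * c))
  e₃ = solve-∀
  e₄ : ∀ K c′ → 4 * K * (suc K * c′) * (suc K * c′) ≡ K * suc K * (4 * suc K * c′ * c′)
  e₄ = solve-∀

length-ones-zeros : ∀ s → length s ≡ ones s + zeros s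
length-ones-zeros []          = refl
length-ones-zeros (true ∷ s)  = cong suc (length-ones-zeros s)
length-ones-zeros (false ∷ s) = trans (cong suc (length-ones-zeros s)) (sym (+-suc (ones s) (zeros s)))

balanced-in-window : ∀ K s → length s ≡ K + K → T (ones s ≡ᵇ K) → T (window 0 1 s)
balanced-in-window K s len balanced =
  subst₂ (λ o z → T ((z ≤ᵇ o + 0) ∧ (o ≤ᵇ z + 1))) (sym ones≡K) (sym zeros≡K)
    (Equivalence.from (T-∧ {K ≤ᵇ K + 0} {K ≤ᵇ K + 1}) (≤⇒≤ᵇ (m≤m+n K 0) , ≤⇒≤ᵇ (m≤m+n K 1)))
  where
  open ≡-Reasoning
  ones≡K : ones s ≡ K
  ones≡K = ≡ᵇ⇒≡ (ones s) K balanced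
  zeros≡K : zeros s ≡ K
  zeros≡K = +-cancelˡ-≡ K (zeros s) K (begin
    K + zeros s      ≡⟨ cong (_+ zeros s) ones≡K ⟨
    ones s + zeros s ≡⟨ length-ones-zeros s ⟨
    length s         ≡⟨ len ⟩
    K + K            ∎)

-- F_{2K+1} ≥ C(2K, K): a ballot sequence is a one followed by a nonnegative walk.
central≤ballot : ∀ K → central K ≤ count ballot (suc (K + K))
central≤ballot K = begin
    central K
  ≡⟨ count-ones (K + K) K ⟨
    count (λ s → ones s ≡ᵇ K) (K + K)
  ≤⟨ count-mono (K + K) (balanced-in-window K) ⟩
    count (window 0 1) (K + K)
  ≡⟨ nonneg-count (K + K) 0 ⟨
    count (nonneg 0) (K + K)
  ≡⟨ +-identityʳ _ ⟨
    count (nonneg 0) (K + K) + 0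
  ≡⟨ cong (count (nonneg 0) (K + K) +_) (count-never (K + K)) ⟨
    count ballot (suc (K + K))
  ∎
  where open ≤-Reasoning

square-pow-odd : ∀ K → 2 ^ suc (K + K) * 2 ^ suc (K + K) ≡ 4 * 16 ^ K
square-pow-odd K = begin
    2 ^ ℓ * 2 ^ ℓ     ≡⟨ ^-distribˡ-+-* 2 ℓ ℓ ⟨
    2 ^ (ℓ + ℓ)       ≡⟨ cong (2 ^_) (double K) ⟩
    2 ^ (2 + 4 * K)   ≡⟨ ^-distribˡ-+-* 2 2 (4 * K) ⟩
    4 * 2 ^ (4 * K)   ≡⟨ cong (4 *_) (^-*-assoc 2 4 K) ⟨
    4 * 16 ^ K        ∎
  where
  open ≡-Reasoning
  ℓ = suc (K + K)
  double : ∀ K → suc (K + K) + suc (K + K) ≡ 2 + 4 * K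
  double = solve-∀

odd-bound : ∀ m → let K = suc m; ℓ = suc (K + K) in
  K ≤ ℓ ∸ 4 → 2 ^ ℓ ≤ 16 * (ℓ ∸ 4) * B ℓ
odd-bound m K≤d = *-cancelʳ-≤ (2 ^ ℓ) (16 * d * B ℓ) (2 ^ ℓ) {{m^n≢0 2 ℓ}} (begin
    2 ^ ℓ * 2 ^ ℓ
  ≡⟨ square-pow-odd K ⟩
    4 * 16 ^ K
  ≤⟨ *-monoʳ-≤ 4 (central-bound m) ⟩
    4 * (4 * K * c * c)
  ≡⟨ regroup K c ⟩
    16 * K * (c * c)
  ≤⟨ *-mono-≤ (*-monoʳ-≤ 16 K≤d) (*-mono-≤ (central≤ballot K) (central≤ballot K)) ⟩
    16 * d * (F * F)
  ≤⟨ *-monoʳ-≤ (16 * d) (ballot-square ℓ) ⟩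
    16 * d * (B ℓ * 2 ^ ℓ)
  ≡⟨ *-assoc (16 * d) (B ℓ) (2 ^ ℓ) ⟨
    16 * d * B ℓ * 2 ^ ℓ
  ∎)
  where
  open ≤-Reasoning
  K = suc m
  ℓ = suc (K + K)
  d = ℓ ∸ 4
  c = central K
  F = count ballot ℓ
  regroup : ∀ K c → 4 * (4 * K * c * c) ≡ 16 * K * (c * c)
  regroup = solve-∀

odd-form : ∀ ℓ → ¬ 2 ∣ ℓ → ∃[ k ] ℓ ≡ suc (k + k)
odd-form zero          ℓ-odd = ⊥-elim (ℓ-odd (divides 0 refl))
odd-form (suc zero)    _     = 0 , refl
odd-form (suc (suc ℓ)) ℓ-odd with odd-form ℓ (ℓ-odd ∘ ∣m∣n⇒∣m+n ∣-refl)
... | k , refl = suc k , cong (suc ∘ suc) (sym (+-suc k k))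

corollary4p8 : ∀ (ℓ : ℕ) → ¬ (2 ∣ ℓ) → 4 < ℓ → 2 ^ ℓ ≤ 16 * (ℓ ∸ 4) * B ℓ
corollary4p8 ℓ ℓ-odd 4<ℓ with odd-form ℓ ℓ-odd
... | k , refl = for-odd k 4<ℓ
  where
  for-odd : ∀ k → 4 < suc (k + k) → 2 ^ suc (k + k) ≤ 16 * (suc (k + k) ∸ 4) * B (suc (k + k))
  for-odd 0                   (s≤s ())
  for-odd 1                   (s≤s (s≤s (s≤s ())))
  -- ℓ = 5: 2^5 = 32 = 16 · 1 · B_5, by computation (B_5 = 2).
  for-odd 2                   _ = ≤-refl
  for-odd (suc (suc (suc m))) _ = odd-bound (suc (suc m)) (m≤n+m (3 + m) m)
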